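{- For all $n\ge1$, $a_{n,3,012}=2^{n-4}(n^2+5n+2)$.
   Context: For a finite integer sequence $(a_1,\dots,a_i)$, $\mathrm{asc}(a_1,\dots,a_i)=|\{j:1\le j<i,\ a_j<a_{j+1}\}|$. For an integer $p\ge1$, a $p$-ascent sequence of length $n\ge1$ is a sequence $(a_1,\dots,a_n)$ of nonnegative integers with $a_1=0$ and $a_i\le p+\mathrm{asc}(a_1,\dots,a_{i-1})$ for all $2\le i\le n$. A sequence $w=w_1\dots w_n$ avoids the pattern $012$ if there are no indices $i<j<k$ with $w_i<w_j<w_k$. $a_{n,p,012}$ is the number of $p$-ascent sequences of length $n$ avoiding $012$. -}

module Defs where

open import Data.Nat using (ℕ; zero; suc; _+_; _≤_; _<_; _<ᵇ_; _≤?_; _<?_; _≟_)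
open import Data.Fin using (Fin; toℕ)
open import Data.Fin.Properties using (all?)
open import Data.List using (List; []; _∷_; [_]; take; length; filter; map; concatMap; upTo)
open import Data.Vec using (Vec; lookup; toList) renaming ([] to []ᵥ; _∷_ to _∷ᵥ_)
open import Data.Bool using (if_then_else_)
open import Data.Product using (_×_)
open import Relation.Nullary using (¬_; Dec)
open import Relation.Nullary.Decidable using (_×-dec_; _→-dec_; ¬?)
open import Relation.Binary.PropositionalEquality using (_≡_)

asc : List ℕ → ℕ
asc []           = 0
asc (x ∷ [])     = 0
asc (x ∷ y ∷ r)  = (if x <ᵇ y then 1 else 0) + asc (y ∷ r)

IsPAscent : (p : ℕ) {n : ℕ} → Vec ℕ n → Set
IsPAscent p {n} a =
  ((i : Fin n) → toℕ i ≡ 0 → lookup a i ≡ 0) ×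
  ((i : Fin n) → 1 ≤ toℕ i → lookup a i ≤ p + asc (take (toℕ i) (toList a)))

Avoids012 : {n : ℕ} → Vec ℕ n → Set
Avoids012 {n} a = (i j k : Fin n) → toℕ i < toℕ j → toℕ j < toℕ k →
  ¬ (lookup a i < lookup a j × lookup a j < lookup a k)

isPAscent? : (p : ℕ) {n : ℕ} (a : Vec ℕ n) → Dec (IsPAscent p a)
isPAscent? p a =
  all? (λ i → (toℕ i ≟ 0) →-dec (lookup a i ≟ 0)) ×-dec
  all? (λ i → (1 ≤? toℕ i) →-dec (lookup a i ≤? p + asc (take (toℕ i) (toList a))))

avoids012? : {n : ℕ} (a : Vec ℕ n) → Dec (Avoids012 a)
avoids012? a = all? λ i → all? λ j → all? λ k →
  (toℕ i <? toℕ j) →-dec ((toℕ j <? toℕ k) →-dec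
    ¬? ((lookup a i <? lookup a j) ×-dec (lookup a j <? lookup a k)))

allVecs : (B n : ℕ) → List (Vec ℕ n)
allVecs B zero    = [ []ᵥ ]
allVecs B (suc n) = concatMap (λ x → map (x ∷ᵥ_) (allVecs B n)) (upTo B)

-- a_{n,p,012}: number of p-ascent sequences of length n avoiding 012.
-- Every p-ascent sequence of length n has entries ≤ p + (n - 2) < p + n
-- (since asc of a prefix of length i is ≤ i - 1), so enumerating vectors
-- with entries < p + n loses nothing.
countAsc012 : (n p : ℕ) → ℕ
countAsc012 n p =
  length (filter (λ a → isPAscent? p a ×-dec avoids012? a) (allVecs (p + n) n))

-- A p-ascent sequence avoiding 012 starts with 0, so every positive entry
-- must dominate all later entries; hence the positive entries are weakly
-- decreasing, and the first of them, preceded only by zeros (no ascent),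
-- is at most p.  Conversely any such sequence is a p-ascent sequence
-- avoiding 012, since p + asc ≥ p.  So a_{n+1,p,012} counts the words of
-- length n whose positive letters decrease weakly from at most p.  Writing
-- D_m(n) for these counts with bound m and splitting on the first letter
-- gives D_m(n+1) = D_m(n) + D_1(n) + ⋯ + D_m(n), whence D_1(n) = 2^n,
-- D_2(n) = 2^(n-1)(n+2) and D_3(n) = 2^(n-3)(n²+7n+8).
module Submission where

open import Defs
open import Data.Bool using (Bool; true; false; T; _∧_)
open import Data.Bool.Properties using (T-∧)
open import Data.Empty using (⊥-elim)
open import Data.Fin using (toℕ; zero; suc)
open import Data.List using (List; []; _∷_; _++_; map; concatMap; applyUpTo; upTo; take; filter; filterᵇ; length)
open import Data.List.Properties using (length-++; filter-++; filter-≐; concatMap-++)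
open import Data.Nat using (ℕ; zero; suc; _+_; _*_; _^_; _≤_; _<_; _≤ᵇ_; z≤n; s≤s; z<s)
open import Data.Nat.ListAction using (sum)
open import Data.Nat.Properties
  using (≤-trans; ≤-reflexive; ≤-<-trans; ≤⇒≯; ≮⇒≥; m≤m+n; 1+n≢0; ≤ᵇ⇒≤; ≤⇒≤ᵇ; +-identityʳ; *-assoc)
open import Data.Nat.Tactic.RingSolver using (solve-∀)
open import Data.Product using (_×_; _,_; proj₁; proj₂)
open import Data.Unit using (tt)
open import Data.Vec using (Vec; []; _∷_; lookup; toList)
open import Function using (_∘_; Equivalence)
open import Relation.Nullary using (T?; _×-dec_)
open import Relation.Unary using (_≐_)
open import Relation.Binary.PropositionalEquality using (_≡_; refl; trans; cong; cong₂; module ≡-Reasoning)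
open ≡-Reasoning

private
  variable
    n : ℕ
    A C : Set

Bounded : ℕ → Vec ℕ n → Set
Bounded m b = ∀ j → lookup b j ≤ m

PositivesDominate : Vec ℕ n → Set
PositivesDominate b = ∀ j k → toℕ j < toℕ k → 0 < lookup b j → lookup b k ≤ lookup b j

Bounded-tail : ∀ {m x} {b : Vec ℕ n} → Bounded m (x ∷ b) → Bounded m b
Bounded-tail bounded j = bounded (suc j)

PositivesDominate-tail : ∀ {x} {b : Vec ℕ n} → PositivesDominate (x ∷ b) → PositivesDominate b
PositivesDominate-tail dominate j k j<k = dominate (suc j) (suc k) (s≤s j<k)

descendsᵇ : ℕ → Vec ℕ n → Bool
descendsᵇ m []          = true
descendsᵇ m (zero  ∷ b) = descendsᵇ m b
descendsᵇ m (suc x ∷ b) = (suc x ≤ᵇ m) ∧ descendsᵇ (suc x) b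

descendsᵇ-head : ∀ m {x} (b : Vec ℕ n) → T (descendsᵇ m (suc x ∷ b)) → suc x ≤ m
descendsᵇ-head m {x} b t = ≤ᵇ⇒≤ (suc x) m (proj₁ (Equivalence.to T-∧ t))

descendsᵇ-tail : ∀ m {x} (b : Vec ℕ n) → T (descendsᵇ m (suc x ∷ b)) → T (descendsᵇ (suc x) b)
descendsᵇ-tail m b t = proj₂ (Equivalence.to T-∧ t)

descendsᵇ⇒Bounded : ∀ m (b : Vec ℕ n) → T (descendsᵇ m b) → Bounded m b
descendsᵇ⇒Bounded m (zero  ∷ b) t zero    = z≤n
descendsᵇ⇒Bounded m (zero  ∷ b) t (suc j) = descendsᵇ⇒Bounded m b t j
descendsᵇ⇒Bounded m (suc x ∷ b) t zero    = descendsᵇ-head m b t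
descendsᵇ⇒Bounded m (suc x ∷ b) t (suc j) =
  ≤-trans (descendsᵇ⇒Bounded (suc x) b (descendsᵇ-tail m b t) j) (descendsᵇ-head m b t)

descendsᵇ⇒PositivesDominate : ∀ m (b : Vec ℕ n) → T (descendsᵇ m b) → PositivesDominate b
descendsᵇ⇒PositivesDominate m (x ∷ b) t j zero ()
descendsᵇ⇒PositivesDominate m (zero ∷ b) t zero (suc k) _ ()
descendsᵇ⇒PositivesDominate m (zero ∷ b) t (suc j) (suc k) (s≤s j<k) =
  descendsᵇ⇒PositivesDominate m b t j k j<k
descendsᵇ⇒PositivesDominate m (suc x ∷ b) t zero (suc k) _ _ =
  descendsᵇ⇒Bounded (suc x) b (descendsᵇ-tail m b t) k
descendsᵇ⇒PositivesDominate m (suc x ∷ b) t (suc j) (suc k) (s≤s j<k) =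
  descendsᵇ⇒PositivesDominate (suc x) b (descendsᵇ-tail m b t) j k j<k

Bounded∧PositivesDominate⇒descendsᵇ :
  ∀ m (b : Vec ℕ n) → Bounded m b → PositivesDominate b → T (descendsᵇ m b)
Bounded∧PositivesDominate⇒descendsᵇ m [] bounded dominate = tt
Bounded∧PositivesDominate⇒descendsᵇ m (zero ∷ b) bounded dominate =
  Bounded∧PositivesDominate⇒descendsᵇ m b (Bounded-tail bounded) (PositivesDominate-tail dominate)
Bounded∧PositivesDominate⇒descendsᵇ m (suc x ∷ b) bounded dominate =
  Equivalence.from T-∧ (≤⇒≤ᵇ (bounded zero) ,
    Bounded∧PositivesDominate⇒descendsᵇ (suc x) b
      (λ j → dominate zero (suc j) z<s z<s) (PositivesDominate-tail dominate))

-- asc of 0 followed by zeros vanishes, so the first positive entry is at most p.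
ascentBound⇒Bounded : ∀ p (b : Vec ℕ n) →
  (∀ j → lookup b j ≤ p + asc (0 ∷ take (toℕ j) (toList b))) →
  PositivesDominate b → Bounded p b
ascentBound⇒Bounded p (zero ∷ b) ascent dominate zero = z≤n
ascentBound⇒Bounded p (zero ∷ b) ascent dominate (suc j) =
  ascentBound⇒Bounded p b (λ j → ascent (suc j)) (PositivesDominate-tail dominate) j
ascentBound⇒Bounded p (suc x ∷ b) ascent dominate zero =
  ≤-trans (ascent zero) (≤-reflexive (+-identityʳ p))
ascentBound⇒Bounded p (suc x ∷ b) ascent dominate (suc j) =
  ≤-trans (dominate zero (suc j) z<s z<s) (ascentBound⇒Bounded p (suc x ∷ b) ascent dominate zero)

Ascent012 : ℕ → Vec ℕ n → Set
Ascent012 p a = IsPAscent p a × Avoids012 a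

ascent012ᵇ : ℕ → Vec ℕ (suc n) → Bool
ascent012ᵇ p (zero  ∷ b) = descendsᵇ p b
ascent012ᵇ p (suc _ ∷ b) = false

Ascent012⇒ascent012ᵇ : ∀ p (a : Vec ℕ (suc n)) → Ascent012 p a → T (ascent012ᵇ p a)
Ascent012⇒ascent012ᵇ p (suc x ∷ b) ((startsAt0 , _) , _) = ⊥-elim (1+n≢0 (startsAt0 zero refl))
Ascent012⇒ascent012ᵇ p (zero ∷ b) ((_ , ascent) , avoids) =
  Bounded∧PositivesDominate⇒descendsᵇ p b
    (ascentBound⇒Bounded p b (λ j → ascent (suc j) (s≤s z≤n)) dominate) dominate
  where
  dominate : PositivesDominate b
  dominate j k j<k 0<bⱼ =
    ≮⇒≥ (λ bⱼ<bₖ → avoids zero (suc j) (suc k) z<s (s≤s j<k) (0<bⱼ , bⱼ<bₖ))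

ascent012ᵇ⇒Ascent012 : ∀ p (a : Vec ℕ (suc n)) → T (ascent012ᵇ p a) → Ascent012 p a
ascent012ᵇ⇒Ascent012 p (zero ∷ b) t = (startsAt0 , ascent) , avoids
  where
  startsAt0 : ∀ i → toℕ i ≡ 0 → lookup (0 ∷ b) i ≡ 0
  startsAt0 zero _ = refl

  ascent : ∀ i → 1 ≤ toℕ i → lookup (0 ∷ b) i ≤ p + asc (take (toℕ i) (toList (0 ∷ b)))
  ascent (suc j) _ = ≤-trans (descendsᵇ⇒Bounded p b t j) (m≤m+n p _)

  avoids : Avoids012 (0 ∷ b)
  avoids i zero k () _
  avoids i (suc j) zero _ ()
  avoids i (suc j) (suc k) _ (s≤s j<k) (aᵢ<bⱼ , bⱼ<bₖ) =
    ≤⇒≯ (descendsᵇ⇒PositivesDominate p b t j k j<k (≤-<-trans z≤n aᵢ<bⱼ)) bⱼ<bₖ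

Ascent012≐ascent012ᵇ : ∀ p → Ascent012 {suc n} p ≐ (T ∘ ascent012ᵇ p)
Ascent012≐ascent012ᵇ p = Ascent012⇒ascent012ᵇ p _ , ascent012ᵇ⇒Ascent012 p _

countᵇ : (A → Bool) → List A → ℕ
countᵇ g xs = length (filterᵇ g xs)

countᵇ-++ : ∀ (g : A → Bool) xs ys → countᵇ g (xs ++ ys) ≡ countᵇ g xs + countᵇ g ys
countᵇ-++ g xs ys = trans (cong length (filter-++ (T? ∘ g) xs ys)) (length-++ (filterᵇ g xs))

countᵇ-map : ∀ (g : C → Bool) (f : A → C) xs → countᵇ g (map f xs) ≡ countᵇ (g ∘ f) xs
countᵇ-map g f []       = refl
countᵇ-map g f (x ∷ xs) with g (f x)
... | true  = cong suc (countᵇ-map g f xs)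
... | false = countᵇ-map g f xs

countᵇ-none : ∀ {g : A → Bool} → (∀ x → g x ≡ false) → ∀ xs → countᵇ g xs ≡ 0
countᵇ-none g≡false []       = refl
countᵇ-none g≡false (x ∷ xs) rewrite g≡false x = countᵇ-none g≡false xs

applyUpTo-+ : ∀ (f : ℕ → A) k l → applyUpTo f (k + l) ≡ applyUpTo f k ++ applyUpTo (f ∘ (k +_)) l
applyUpTo-+ f zero    l = refl
applyUpTo-+ f (suc k) l = cong (f 0 ∷_) (applyUpTo-+ (f ∘ suc) k l)

prependEach : List ℕ → List (Vec ℕ n) → List (Vec ℕ (suc n))
prependEach xs V = concatMap (λ x → map (x ∷_) V) xs

countᵇ-prependEach : ∀ (g : Vec ℕ (suc n) → Bool) xs V →
  countᵇ g (prependEach xs V) ≡ sum (map (λ x → countᵇ (λ b → g (x ∷ b)) V) xs)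
countᵇ-prependEach g []       V = refl
countᵇ-prependEach g (x ∷ xs) V =
  trans (countᵇ-++ g (map (x ∷_) V) (prependEach xs V))
        (cong₂ _+_ (countᵇ-map g (x ∷_) V) (countᵇ-prependEach g xs V))

countᵇ-prependEach-none : ∀ (g : Vec ℕ (suc n) → Bool) (f : ℕ → ℕ) l V →
  (∀ i b → g (f i ∷ b) ≡ false) → countᵇ g (prependEach (applyUpTo f l) V) ≡ 0
countᵇ-prependEach-none g f zero    V g≡false = refl
countᵇ-prependEach-none g f (suc l) V g≡false = begin
  countᵇ g (map (f 0 ∷_) V ++ prependEach (applyUpTo (f ∘ suc) l) V)
    ≡⟨ countᵇ-++ g (map (f 0 ∷_) V) _ ⟩
  countᵇ g (map (f 0 ∷_) V) + countᵇ g (prependEach (applyUpTo (f ∘ suc) l) V)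
    ≡⟨ cong₂ _+_ (trans (countᵇ-map g (f 0 ∷_) V) (countᵇ-none (g≡false 0) V))
                 (countᵇ-prependEach-none g (f ∘ suc) l V (g≡false ∘ suc)) ⟩
  0 ∎

countᵇ-allVecs-suc : ∀ h l (g : Vec ℕ (suc n) → Bool) → (∀ i b → g (h + i ∷ b) ≡ false) →
  countᵇ g (allVecs (h + l) (suc n)) ≡ sum (map (λ x → countᵇ (λ b → g (x ∷ b)) (allVecs (h + l) n)) (upTo h))
countᵇ-allVecs-suc {n} h l g g≡false = begin
  countᵇ g (prependEach (upTo (h + l)) V)
    ≡⟨ cong (λ xs → countᵇ g (prependEach xs V)) (applyUpTo-+ (λ x → x) h l) ⟩
  countᵇ g (prependEach (upTo h ++ applyUpTo (h +_) l) V)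
    ≡⟨ cong (countᵇ g) (concatMap-++ (λ x → map (x ∷_) V) (upTo h) _) ⟩
  countᵇ g (prependEach (upTo h) V ++ prependEach (applyUpTo (h +_) l) V)
    ≡⟨ countᵇ-++ g (prependEach (upTo h) V) _ ⟩
  countᵇ g (prependEach (upTo h) V) + countᵇ g (prependEach (applyUpTo (h +_) l) V)
    ≡⟨ cong₂ _+_ (countᵇ-prependEach g (upTo h) V) (countᵇ-prependEach-none g (h +_) l V g≡false) ⟩
  sum (map (λ x → countᵇ (λ b → g (x ∷ b)) V) (upTo h)) + 0
    ≡⟨ +-identityʳ _ ⟩
  sum (map (λ x → countᵇ (λ b → g (x ∷ b)) V) (upTo h)) ∎
  where
  V : List (Vec ℕ n)
  V = allVecs (h + l) n

countAscent012≡countDescends : ∀ p l n →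
  length (filter (λ a → isPAscent? p a ×-dec avoids012? a) (allVecs (suc l) (suc n)))
    ≡ countᵇ (descendsᵇ p) (allVecs (suc l) n)
countAscent012≡countDescends p l n = begin
  length (filter (λ a → isPAscent? p a ×-dec avoids012? a) (allVecs (suc l) (suc n)))
    ≡⟨ cong length (filter-≐ _ (T? ∘ ascent012ᵇ p) (Ascent012≐ascent012ᵇ p) (allVecs (suc l) (suc n))) ⟩
  countᵇ (ascent012ᵇ p) (allVecs (1 + l) (suc n))
    ≡⟨ countᵇ-allVecs-suc {n = n} 1 l (ascent012ᵇ p) (λ _ _ → refl) ⟩
  countᵇ (descendsᵇ p) (allVecs (suc l) n) + 0
    ≡⟨ +-identityʳ _ ⟩
  countᵇ (descendsᵇ p) (allVecs (suc l) n) ∎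

-- Letters range over {0, …, l + 3}; any l works since letters above 3 never occur.
module DescendsCount (l : ℕ) where

  descendsCount : ℕ → ℕ → ℕ
  descendsCount m n = countᵇ (descendsᵇ m) (allVecs (4 + l) n)

  descendsCount₁ : ∀ n → descendsCount 1 n ≡ 2 ^ n
  descendsCount₁ zero    = refl
  descendsCount₁ (suc n) = begin
    descendsCount 1 (suc n)
      ≡⟨ countᵇ-allVecs-suc {n = n} 2 (2 + l) (descendsᵇ 1) (λ _ _ → refl) ⟩
    descendsCount 1 n + (descendsCount 1 n + 0)
      ≡⟨ cong (λ d → d + (d + 0)) (descendsCount₁ n) ⟩
    2 ^ suc n ∎

  descendsCount₂ : ∀ n → 2 * descendsCount 2 n ≡ 2 ^ n * (n + 2)
  descendsCount₂ zero    = refl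
  descendsCount₂ (suc n) = begin
    2 * descendsCount 2 (suc n)
      ≡⟨ cong (2 *_) (countᵇ-allVecs-suc {n = n} 3 (1 + l) (descendsᵇ 2) (λ _ _ → refl)) ⟩
    2 * (descendsCount 2 n + (descendsCount 1 n + (descendsCount 2 n + 0)))
      ≡⟨ expand (descendsCount 2 n) (descendsCount 1 n) ⟩
    2 * descendsCount 2 n + 2 * descendsCount 2 n + 2 * descendsCount 1 n
      ≡⟨ cong₂ (λ d₂ d₁ → d₂ + d₂ + 2 * d₁) (descendsCount₂ n) (descendsCount₁ n) ⟩
    2 ^ n * (n + 2) + 2 ^ n * (n + 2) + 2 * 2 ^ n
      ≡⟨ collect (2 ^ n) n ⟩
    2 ^ suc n * (suc n + 2) ∎
    where
    expand : ∀ d₂ d₁ → 2 * (d₂ + (d₁ + (d₂ + 0))) ≡ 2 * d₂ + 2 * d₂ + 2 * d₁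
    expand = solve-∀
    collect : ∀ q n → q * (n + 2) + q * (n + 2) + 2 * q ≡ 2 * q * (suc n + 2)
    collect = solve-∀

  descendsCount₃ : ∀ n → 8 * descendsCount 3 n ≡ 2 ^ n * (n * n + 7 * n + 8)
  descendsCount₃ zero    = refl
  descendsCount₃ (suc n) = begin
    8 * descendsCount 3 (suc n)
      ≡⟨ cong (8 *_) (countᵇ-allVecs-suc {n = n} 4 l (descendsᵇ 3) (λ _ _ → refl)) ⟩
    8 * (descendsCount 3 n + (descendsCount 1 n + (descendsCount 2 n + (descendsCount 3 n + 0))))
      ≡⟨ expand (descendsCount 3 n) (descendsCount 2 n) (descendsCount 1 n) ⟩
    2 * (8 * descendsCount 3 n) + 4 * (2 * descendsCount 2 n) + 8 * descendsCount 1 n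
      ≡⟨ cong₂ (λ d₃ d₂ → 2 * d₃ + 4 * d₂ + 8 * descendsCount 1 n) (descendsCount₃ n) (descendsCount₂ n) ⟩
    2 * (2 ^ n * (n * n + 7 * n + 8)) + 4 * (2 ^ n * (n + 2)) + 8 * descendsCount 1 n
      ≡⟨ cong (λ d₁ → 2 * (2 ^ n * (n * n + 7 * n + 8)) + 4 * (2 ^ n * (n + 2)) + 8 * d₁) (descendsCount₁ n) ⟩
    2 * (2 ^ n * (n * n + 7 * n + 8)) + 4 * (2 ^ n * (n + 2)) + 8 * 2 ^ n
      ≡⟨ collect (2 ^ n) n ⟩
    2 ^ suc n * (suc n * suc n + 7 * suc n + 8) ∎
    where
    expand : ∀ d₃ d₂ d₁ → 8 * (d₃ + (d₁ + (d₂ + (d₃ + 0)))) ≡ 2 * (8 * d₃) + 4 * (2 * d₂) + 8 * d₁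
    expand = solve-∀
    collect : ∀ q n → 2 * (q * (n * n + 7 * n + 8)) + 4 * (q * (n + 2)) + 8 * q
                        ≡ 2 * q * (suc n * suc n + 7 * suc n + 8)
    collect = solve-∀

open DescendsCount using (descendsCount; descendsCount₃)

mainTheorem16 : (n : ℕ) → 1 ≤ n →
    16 * countAsc012 n 3 ≡ 2 ^ n * (n * n + 5 * n + 2)
mainTheorem16 (suc n) _ = begin
  16 * countAsc012 (suc n) 3             ≡⟨ cong (16 *_) (countAscent012≡countDescends 3 (3 + n) n) ⟩
  16 * descendsCount n 3 n               ≡⟨ *-assoc 2 8 (descendsCount n 3 n) ⟩
  2 * (8 * descendsCount n 3 n)          ≡⟨ cong (2 *_) (descendsCount₃ n n) ⟩
  2 * (2 ^ n * (n * n + 7 * n + 8))      ≡⟨ shift (2 ^ n) n ⟩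
  2 ^ suc n * (suc n * suc n + 5 * suc n + 2) ∎
  where
  shift : ∀ q n → 2 * (q * (n * n + 7 * n + 8)) ≡ 2 * q * (suc n * suc n + 5 * suc n + 2)
  shift = solve-∀
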